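{- Let $n\ge1$. Let $\Gamma_n$ be the graph whose vertices are the words of length $n$ over $\{0,1,2\}$ (a word $x_1\dots x_n$ encodes the Hanoi Towers configuration on pegs $0,1,2$ in which disk $j$ — disks numbered $1,\dots,n$ by increasing size — lies on peg $x_j$), with an edge between $w$ and $a_{ij}(w)$ for each $0\le i<j\le2$, where $a_{ij}$ changes the first occurrence of either letter $i$ or $j$ in $w$ into the other one (if such an occurrence exists). For distinct $x,y\in\{0,1,2\}$ there is a unique shortest path in $\Gamma_n$ from $x^n$ to $y^n$ (of length $2^n-1$). Consider the transducer $\mathcal O_H'$ with states $q_{xy}$ for all ordered pairs of distinct $x,y\in\{0,1,2\}$, where, letting $z$ be the third element of $\{0,1,2\}$, the state $q_{xy}$ on input $0$ outputs $x$ and moves to $q_{xz}$, and on input $1$ outputs $y$ and moves to $q_{zy}$. For $0\le i\le 2^n-1$ let $[i]_2=i_0i_1\dots i_{n-1}$ be the length-$n$ binary representation of $i$ written least significant digit first ($i=\sum_j i_j2^j$, padded with zeros). Then for all distinct $x,y$ and all $0\le i\le 2^n-1$, feeding the reversal $[i]_2^R=i_{n-1}\dots i_0$ into $\mathcal O_H'$ starting at state $q_{xy}$ produces the reversal of the word representing the configuration at distance $i$ from $x^n$ along the shortest path from $x^n$ to $y^n$ in $\Gamma_n$. -}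

module Defs where

open import Data.Nat using (ℕ; zero; suc; _≤_; _<_)
open import Data.Nat.DivMod using (_mod_; _/_)
open import Data.Fin using (Fin; zero; suc; toℕ) renaming (_<_ to _<ᶠ_)
open import Data.Fin.Properties using (_≟_)
open import Data.Vec using (Vec; []; _∷_; replicate)
open import Data.Product using (Σ; ∃; _×_; _,_)
open import Data.Sum using (_⊎_)
open import Relation.Nullary using (yes; no)
open import Relation.Binary.PropositionalEquality using (_≡_)

Letter : Set
Letter = Fin 3

-- A vertex of Γ_n: word x_1 … x_n (head of the vector = x_1 = smallest disk)
Word : ℕ → Set
Word n = Vec Letter n

flipFirst : ∀ {n} → Letter → Letter → Word n → Word n
flipFirst i j [] = []
flipFirst i j (c ∷ w) with c ≟ i | c ≟ j
... | yes _ | _     = j ∷ w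
... | no _  | yes _ = i ∷ w
... | no _  | no _  = c ∷ flipFirst i j w

Adj : ∀ {n} → Word n → Word n → Set
Adj w v = Σ Letter λ i → Σ Letter λ j → i <ᶠ j × (v ≡ flipFirst i j w ⊎ w ≡ flipFirst i j v)

record Walk (n : ℕ) (u v : Word n) (m : ℕ) : Set where
  field
    vtx   : Fin (suc m) → Word n
    start : vtx zero ≡ u
    end   : vtx (Data.Fin.fromℕ m) ≡ v
    step  : (k : Fin m) → Adj (vtx (Data.Fin.inject₁ k)) (vtx (suc k))

IsShortest : ∀ {n} {u v : Word n} {m : ℕ} → Walk n u v m → Set
IsShortest {n} {u} {v} {m} _ = ∀ m' → Walk n u v m' → m ≤ m'

-- the third element of {0,1,2} (for x ≠ y; the diagonal values are irrelevant)
third : Letter → Letter → Letter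
third zero zero = zero
third zero (suc zero) = suc (suc zero)
third zero (suc (suc zero)) = suc zero
third (suc zero) zero = suc (suc zero)
third (suc zero) (suc zero) = suc zero
third (suc zero) (suc (suc zero)) = zero
third (suc (suc zero)) zero = suc zero
third (suc (suc zero)) (suc zero) = zero
third (suc (suc zero)) (suc (suc zero)) = suc (suc zero)

runO : ∀ {k} → Letter → Letter → Vec (Fin 2) k → Vec Letter k
runO x y [] = []
runO x y (zero ∷ bs)     = x ∷ runO x (third x y) bs
runO x y (suc zero ∷ bs) = y ∷ runO (third x y) y bs

binLSB : (n : ℕ) → ℕ → Vec (Fin 2) n
binLSB zero i = []
binLSB (suc n) i = (i mod 2) ∷ binLSB n (i / 2)

const : (n : ℕ) → Letter → Word n
const n x = replicate n x

{-# OPTIONS --safe #-}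
module Submission where

-- Write a configuration as w ∷ʳ c, where c is the peg of the largest disk. A move a_ij changes c
-- only if w contains neither i nor j, i.e. only if w is the constant word on the third peg. So on a
-- transfer of the tower from x to y the largest disk must move; before its first move the smaller
-- disks travel from x^n to a constant word, and after its last move from a constant word to y^n.
-- By induction each stretch takes at least 2^n − 1 moves, so the transfer takes at least
-- 2^(n+1) − 1, and equality leaves room for a single move of the largest disk, from x to y, between
-- two shortest transfers of the n smaller disks. Reading the most significant bit first, the
-- transducer follows the same recursion: bit 0 outputs x and continues in q_xz (first half of the
-- path), bit 1 outputs y and continues in q_zy (second half).

open import Defs
open import Data.Nat using (ℕ; zero; suc; _+_; _*_; _≤_; _<_; _∸_; _^_; z≤n; s≤s; NonZero)
open import Data.Nat.Properties
open import Data.Nat.DivMod using (_%_; _mod_; _/_; [m+kn]%n≡m%n; /-congˡ; +-distrib-/-∣ʳ; m*n/n≡m; m<n*o⇒m/o<n; m≤n⇒m%n≡m)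
open import Data.Nat.Divisibility using (divides-refl)
open import Data.Fin using (Fin; zero; suc; toℕ; fromℕ; fromℕ<; inject₁) renaming (_<_ to _<ᶠ_)
open import Data.Fin.Properties using (toℕ-injective; toℕ-fromℕ<; toℕ-fromℕ; toℕ-inject₁; toℕ<n; toℕ≤pred[n]) renaming (_≟_ to _≟ᶠ_; <⇒≢ to <ᶠ⇒≢)
open import Data.Vec using (Vec; []; _∷_; reverse; replicate; _∷ʳ_; init; last; initLast)
open import Data.Vec.Properties using (reverse-∷; reverse-involutive; reverse-reverse; ∷ʳ-injective; ∷ʳ-injectiveˡ; ∷ʳ-injectiveʳ)
open import Data.Product using (Σ; _×_; _,_; proj₁; proj₂)
open import Data.Sum using (_⊎_; inj₁; inj₂)
import Data.Sum as Sum
open import Data.Empty using (⊥-elim)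
open import Relation.Nullary using (¬_; yes; no)
open import Relation.Binary using (tri<; tri≈; tri>)
open import Relation.Binary.Definitions using (DecidableEquality)
open import Relation.Binary.PropositionalEquality
open import Function using (_∘_)

replicate-∷ʳ : ∀ {A : Set} n (a : A) → replicate (suc n) a ≡ replicate n a ∷ʳ a
replicate-∷ʳ zero    a = refl
replicate-∷ʳ (suc n) a = cong (a ∷_) (replicate-∷ʳ n a)

reverse-∷ʳ : ∀ {A : Set} {n} (v : Vec A n) a → reverse (v ∷ʳ a) ≡ a ∷ reverse v
reverse-∷ʳ v a = reverse-reverse (trans (reverse-∷ a (reverse v)) (cong (_∷ʳ a) (reverse-involutive v)))

2^suc : ∀ n → 2 ^ suc n ≡ 2 ^ n + 2 ^ n
2^suc n = cong (2 ^ n +_) (+-identityʳ (2 ^ n))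

suc[2^n∸1]≡2^n : ∀ n → suc (2 ^ n ∸ 1) ≡ 2 ^ n
suc[2^n∸1]≡2^n n = m+[n∸m]≡n (m^n>0 2 n)

%≡%⇒mod≡mod : ∀ {d} .{{_ : NonZero d}} a b → a % d ≡ b % d → a mod d ≡ b mod d
%≡%⇒mod≡mod _ _ eq = toℕ-injective (trans (toℕ-fromℕ< _) (trans eq (sym (toℕ-fromℕ< _))))

sum-squeeze : ∀ {N A B C} → N ≤ A → A ≤ B → N ≤ C → B + C ≡ N + N → A ≡ N × B ≡ N × C ≡ N
sum-squeeze {N} {A} {B} {C} N≤A A≤B N≤C B+C≡N+N =
  ≤-antisym (≤-trans A≤B B≤N) N≤A , ≤-antisym B≤N (≤-trans N≤A A≤B) , ≤-antisym C≤N N≤C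
  where
  B≤N : B ≤ N
  B≤N = +-cancelʳ-≤ N B N (≤-trans (+-mono-≤ (≤-refl {B}) N≤C) (≤-reflexive B+C≡N+N))
  C≤N : C ≤ N
  C≤N = +-cancelˡ-≤ N C N (≤-trans (+-mono-≤ (≤-trans N≤A A≤B) (≤-refl {C})) (≤-reflexive B+C≡N+N))

record FirstChange {A : Set} (h : ℕ → A) (m : ℕ) : Set where
  field
    index   : ℕ
    index<m : index < m
    before  : ∀ k → k ≤ index → h k ≡ h 0
    changed : h (suc index) ≢ h 0

record LastChange {A : Set} (h : ℕ → A) (m : ℕ) : Set where
  field
    index   : ℕ
    index<m : index < m
    changed : h index ≢ h m
    after   : ∀ k → index < k → k ≤ m → h k ≡ h m

module _ {A : Set} (_≟ᴬ_ : DecidableEquality A) where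

  firstChange : ∀ (h : ℕ → A) m → h 0 ≢ h m → FirstChange h m
  firstChange h zero    h0≢hm = ⊥-elim (h0≢hm refl)
  firstChange h (suc m) h0≢hm with h 1 ≟ᴬ h 0
  ... | no h1≢h0  = record { index = 0 ; index<m = s≤s z≤n ; before = λ { zero _ → refl } ; changed = h1≢h0 }
  ... | yes h1≡h0 = record
    { index   = suc index
    ; index<m = s≤s index<m
    ; before  = before′
    ; changed = λ h[2+i]≡h0 → changed (trans h[2+i]≡h0 (sym h1≡h0))
    }
    where
    open FirstChange (firstChange (h ∘ suc) m (h0≢hm ∘ trans (sym h1≡h0)))
    before′ : ∀ k → k ≤ suc index → h k ≡ h 0
    before′ zero    _         = refl
    before′ (suc k) (s≤s k≤i) = trans (before k k≤i) h1≡h0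

  lastChange : ∀ (h : ℕ → A) m → h 0 ≢ h m → LastChange h m
  lastChange h zero    h0≢hm = ⊥-elim (h0≢hm refl)
  lastChange h (suc m) h0≢hm with h m ≟ᴬ h (suc m)
  ... | no hm≢hm+1 = record
    { index   = m
    ; index<m = ≤-refl
    ; changed = hm≢hm+1
    ; after   = λ k m<k k≤m+1 → cong h (≤-antisym k≤m+1 m<k)
    }
  ... | yes hm≡hm+1 = record
    { index   = index
    ; index<m = m<n⇒m<1+n index<m
    ; changed = λ hi≡hm → changed (trans hi≡hm (sym hm≡hm+1))
    ; after   = after′
    }
    where
    open LastChange (lastChange h m (λ h0≡hm → h0≢hm (trans h0≡hm hm≡hm+1)))
    after′ : ∀ k → index < k → k ≤ suc m → h k ≡ h (suc m)
    after′ k i<k k≤m+1 with m≤n⇒m<n∨m≡n k≤m+1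
    ... | inj₁ k<m+1 = trans (after k i<k (≤-pred k<m+1)) hm≡hm+1
    ... | inj₂ k≡m+1 = cong h k≡m+1

third-comm : ∀ x y → third x y ≡ third y x
third-comm zero             zero             = refl
third-comm zero             (suc zero)       = refl
third-comm zero             (suc (suc zero)) = refl
third-comm (suc zero)       zero             = refl
third-comm (suc zero)       (suc zero)       = refl
third-comm (suc zero)       (suc (suc zero)) = refl
third-comm (suc (suc zero)) zero             = refl
third-comm (suc (suc zero)) (suc zero)       = refl
third-comm (suc (suc zero)) (suc (suc zero)) = refl

third-≢ : ∀ x y → x ≢ y → third x y ≢ x × third x y ≢ y
third-≢ zero             zero             x≢y = ⊥-elim (x≢y refl)
third-≢ zero             (suc zero)       _   = (λ ()) , (λ ())
third-≢ zero             (suc (suc zero)) _   = (λ ()) , (λ ())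
third-≢ (suc zero)       zero             _   = (λ ()) , (λ ())
third-≢ (suc zero)       (suc zero)       x≢y = ⊥-elim (x≢y refl)
third-≢ (suc zero)       (suc (suc zero)) _   = (λ ()) , (λ ())
third-≢ (suc (suc zero)) zero             _   = (λ ()) , (λ ())
third-≢ (suc (suc zero)) (suc zero)       _   = (λ ()) , (λ ())
third-≢ (suc (suc zero)) (suc (suc zero)) x≢y = ⊥-elim (x≢y refl)

third-≢ˡ : ∀ {x y} → x ≢ y → third x y ≢ x
third-≢ˡ x≢y = proj₁ (third-≢ _ _ x≢y)

third-≢ʳ : ∀ {x y} → x ≢ y → third x y ≢ y
third-≢ʳ x≢y = proj₂ (third-≢ _ _ x≢y)

third-unique : ∀ {a i j} → a ≢ i → a ≢ j → i ≢ j → a ≡ third i j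
third-unique {zero}           {zero}           a≢i _   _   = ⊥-elim (a≢i refl)
third-unique {suc zero}       {suc zero}       a≢i _   _   = ⊥-elim (a≢i refl)
third-unique {suc (suc zero)} {suc (suc zero)} a≢i _   _   = ⊥-elim (a≢i refl)
third-unique {zero}           {_} {zero}           _ a≢j _ = ⊥-elim (a≢j refl)
third-unique {suc zero}       {_} {suc zero}       _ a≢j _ = ⊥-elim (a≢j refl)
third-unique {suc (suc zero)} {_} {suc (suc zero)} _ a≢j _ = ⊥-elim (a≢j refl)
third-unique {_} {zero}           {zero}           _ _ i≢j = ⊥-elim (i≢j refl)
third-unique {_} {suc zero}       {suc zero}       _ _ i≢j = ⊥-elim (i≢j refl)
third-unique {_} {suc (suc zero)} {suc (suc zero)} _ _ i≢j = ⊥-elim (i≢j refl)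
third-unique {zero}           {suc zero}       {suc (suc zero)} _ _ _ = refl
third-unique {zero}           {suc (suc zero)} {suc zero}       _ _ _ = refl
third-unique {suc zero}       {zero}           {suc (suc zero)} _ _ _ = refl
third-unique {suc zero}       {suc (suc zero)} {zero}           _ _ _ = refl
third-unique {suc (suc zero)} {zero}           {suc zero}       _ _ _ = refl
third-unique {suc (suc zero)} {suc zero}       {zero}           _ _ _ = refl

flipLetter : Letter → Letter → Letter → Letter
flipLetter i j c with c ≟ᶠ i | c ≟ᶠ j
... | yes _ | _     = j
... | no _  | yes _ = i
... | no _  | no _  = c

flipLetter-third : ∀ i j c → c ≢ flipLetter i j c → third c (flipLetter i j c) ≡ third i j
flipLetter-third i j c moved with c ≟ᶠ i | c ≟ᶠ j
... | yes refl | _        = refl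
... | no _     | yes refl = third-comm c i
... | no _     | no _     = ⊥-elim (moved refl)

flipLetter-between : ∀ x y → x ≢ y →
  Σ Letter λ i → Σ Letter λ j → i <ᶠ j × flipLetter i j x ≡ y × third x y ≢ i × third x y ≢ j
flipLetter-between zero             zero             x≢y = ⊥-elim (x≢y refl)
flipLetter-between zero             (suc zero)       _   = zero , suc zero , s≤s z≤n , refl , (λ ()) , (λ ())
flipLetter-between zero             (suc (suc zero)) _   = zero , suc (suc zero) , s≤s z≤n , refl , (λ ()) , (λ ())
flipLetter-between (suc zero)       zero             _   = zero , suc zero , s≤s z≤n , refl , (λ ()) , (λ ())
flipLetter-between (suc zero)       (suc zero)       x≢y = ⊥-elim (x≢y refl)
flipLetter-between (suc zero)       (suc (suc zero)) _   = suc zero , suc (suc zero) , s≤s (s≤s z≤n) , refl , (λ ()) , (λ ())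
flipLetter-between (suc (suc zero)) zero             _   = zero , suc (suc zero) , s≤s z≤n , refl , (λ ()) , (λ ())
flipLetter-between (suc (suc zero)) (suc zero)       _   = suc zero , suc (suc zero) , s≤s (s≤s z≤n) , refl , (λ ()) , (λ ())
flipLetter-between (suc (suc zero)) (suc (suc zero)) x≢y = ⊥-elim (x≢y refl)

-- Moves and the largest disk

module _ {i j t : Letter} (t≢i : t ≢ i) (t≢j : t ≢ j) where

  flipFirst-replicate : ∀ n → flipFirst i j (replicate n t) ≡ replicate n t
  flipFirst-replicate zero = refl
  flipFirst-replicate (suc n) with t ≟ᶠ i | t ≟ᶠ j
  ... | yes t≡i | _       = ⊥-elim (t≢i t≡i)
  ... | no _    | yes t≡j = ⊥-elim (t≢j t≡j)
  ... | no _    | no _    = cong (t ∷_) (flipFirst-replicate n)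

  flipFirst-replicate-∷ʳ : ∀ n c → flipFirst i j (replicate n t ∷ʳ c) ≡ replicate n t ∷ʳ flipLetter i j c
  flipFirst-replicate-∷ʳ zero c with c ≟ᶠ i | c ≟ᶠ j
  ... | yes _ | _     = refl
  ... | no _  | yes _ = refl
  ... | no _  | no _  = refl
  flipFirst-replicate-∷ʳ (suc n) c with t ≟ᶠ i | t ≟ᶠ j
  ... | yes t≡i | _       = ⊥-elim (t≢i t≡i)
  ... | no _    | yes t≡j = ⊥-elim (t≢j t≡j)
  ... | no _    | no _    = cong (t ∷_) (flipFirst-replicate-∷ʳ n c)

flipFirst-∷ʳ : ∀ {n i j} → i ≢ j → (w : Word n) (c : Letter) →
  flipFirst i j (w ∷ʳ c) ≡ flipFirst i j w ∷ʳ c ⊎ w ≡ replicate n (third i j)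
flipFirst-∷ʳ         i≢j []      c = inj₂ refl
flipFirst-∷ʳ {i = i} {j} i≢j (a ∷ w) c with a ≟ᶠ i | a ≟ᶠ j
... | yes _   | _       = inj₁ refl
... | no _    | yes _   = inj₁ refl
... | no a≢i  | no a≢j  = Sum.map (cong (a ∷_)) (cong₂ _∷_ (third-unique a≢i a≢j i≢j)) (flipFirst-∷ʳ i≢j w c)

module _ {i j : Letter} (i≢j : i ≢ j) where

  flipFirst-third-replicate : ∀ n → flipFirst i j (replicate n (third i j)) ≡ replicate n (third i j)
  flipFirst-third-replicate = flipFirst-replicate (third-≢ˡ i≢j) (third-≢ʳ i≢j)

  private
    flipFirst-third-replicate-∷ʳ : ∀ n c →
      flipFirst i j (replicate n (third i j) ∷ʳ c) ≡ replicate n (third i j) ∷ʳ flipLetter i j c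
    flipFirst-third-replicate-∷ʳ = flipFirst-replicate-∷ʳ (third-≢ˡ i≢j) (third-≢ʳ i≢j)

  flipFirst-∷ʳ-unmoved : ∀ {n} (w : Word n) {w' c} → w' ∷ʳ c ≡ flipFirst i j (w ∷ʳ c) → w' ≡ flipFirst i j w
  flipFirst-∷ʳ-unmoved {n} w {c = c} eq with flipFirst-∷ʳ i≢j w c
  ... | inj₁ split = ∷ʳ-injectiveˡ _ _ (trans eq split)
  ... | inj₂ refl  = trans (∷ʳ-injectiveˡ _ _ (trans eq (flipFirst-third-replicate-∷ʳ n c)))
                           (sym (flipFirst-third-replicate n))

  flipFirst-∷ʳ-moved : ∀ {n} (w : Word n) {w' c c'} → w' ∷ʳ c' ≡ flipFirst i j (w ∷ʳ c) → c ≢ c' →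
    w ≡ replicate n (third c c') × w' ≡ w
  flipFirst-∷ʳ-moved {n} w {c = c} eq c≢c' with flipFirst-∷ʳ i≢j w c
  ... | inj₁ split = ⊥-elim (c≢c' (sym (∷ʳ-injectiveʳ _ _ (trans eq split))))
  ... | inj₂ refl  with ∷ʳ-injective _ _ (trans eq (flipFirst-third-replicate-∷ʳ n c))
  ...   | refl , refl = cong (replicate n) (sym (flipLetter-third i j c c≢c')) , refl

Adj-∷ʳ⁻ : ∀ {n} {w w' : Word n} {c} → Adj (w ∷ʳ c) (w' ∷ʳ c) → Adj w w'
Adj-∷ʳ⁻ {w = w} (i , j , i<j , inj₁ eq) = i , j , i<j , inj₁ (flipFirst-∷ʳ-unmoved (<ᶠ⇒≢ i<j) w eq)
Adj-∷ʳ⁻ {w' = w'} (i , j , i<j , inj₂ eq) = i , j , i<j , inj₂ (flipFirst-∷ʳ-unmoved (<ᶠ⇒≢ i<j) w' eq)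

Adj-∷ʳ-≢ : ∀ {n} {w w' : Word n} {c c'} → Adj (w ∷ʳ c) (w' ∷ʳ c') → c ≢ c' →
  w ≡ replicate n (third c c') × w' ≡ replicate n (third c c')
Adj-∷ʳ-≢ {w = w} (i , j , i<j , inj₁ eq) c≢c' with flipFirst-∷ʳ-moved (<ᶠ⇒≢ i<j) w eq c≢c'
... | w≡ , w'≡w = w≡ , trans w'≡w w≡
Adj-∷ʳ-≢ {n} {w' = w'} {c} {c'} (i , j , i<j , inj₂ eq) c≢c'
  with flipFirst-∷ʳ-moved (<ᶠ⇒≢ i<j) w' eq (c≢c' ∘ sym)
... | w'≡ , w≡w' = trans w≡w' w'≡′ , w'≡′
  where
  w'≡′ : w' ≡ replicate n (third c c')
  w'≡′ = trans w'≡ (cong (replicate n) (third-comm c' c))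

-- A move that changes the word. Unlike Adj it survives appending a largest disk (Move-∷ʳ): a_ij
-- fixes w only when w avoids i and j, and then on w ∷ʳ c it moves the largest disk instead.
Move : ∀ {n} → Word n → Word n → Set
Move w w' = Σ Letter λ i → Σ Letter λ j → i <ᶠ j × w' ≡ flipFirst i j w × w' ≢ w

Move⇒Adj : ∀ {n} {w w' : Word n} → Move w w' → Adj w w'
Move⇒Adj (i , j , i<j , eq , _) = i , j , i<j , inj₁ eq

Move-∷ʳ : ∀ {n} {w w' : Word n} c → Move w w' → Move (w ∷ʳ c) (w' ∷ʳ c)
Move-∷ʳ {w = w} c (i , j , i<j , refl , moved) with flipFirst-∷ʳ (<ᶠ⇒≢ i<j) w c
... | inj₁ split = i , j , i<j , sym split , moved ∘ ∷ʳ-injectiveˡ _ _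
... | inj₂ refl  = ⊥-elim (moved (flipFirst-third-replicate (<ᶠ⇒≢ i<j) _))

Move-largest : ∀ n {x y} → x ≢ y → Move (replicate n (third x y) ∷ʳ x) (replicate n (third x y) ∷ʳ y)
Move-largest n {x} {y} x≢y with flipLetter-between x y x≢y
... | i , j , i<j , x↦y , t≢i , t≢j =
  i , j , i<j ,
  sym (trans (flipFirst-replicate-∷ʳ t≢i t≢j n x) (cong (replicate n (third x y) ∷ʳ_) x↦y)) ,
  x≢y ∘ sym ∘ ∷ʳ-injectiveʳ _ _

-- The transducer

binLSB-∷ʳ : ∀ n r (b : Fin 2) → r < 2 ^ n → binLSB (suc n) (r + toℕ b * 2 ^ n) ≡ binLSB n r ∷ʳ b
binLSB-∷ʳ zero    zero zero       _ = refl
binLSB-∷ʳ zero    zero (suc zero) _ = refl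
binLSB-∷ʳ zero    (suc r) _       (s≤s ())
binLSB-∷ʳ (suc n) r    b          r<2ⁿ⁺¹ = cong₂ _∷_ lowest-bit (trans (cong (binLSB (suc n)) halve) rest)
  where
  high : ℕ
  high = toℕ b * 2 ^ n
  regroup : r + toℕ b * 2 ^ suc n ≡ r + high * 2
  regroup = cong (r +_) (trans (cong (toℕ b *_) (*-comm 2 (2 ^ n))) (sym (*-assoc (toℕ b) (2 ^ n) 2)))
  lowest-bit : (r + toℕ b * 2 ^ suc n) mod 2 ≡ r mod 2
  lowest-bit = %≡%⇒mod≡mod (r + toℕ b * 2 ^ suc n) r
                 (trans (cong (_% 2) regroup) ([m+kn]%n≡m%n r high 2))
  halve : (r + toℕ b * 2 ^ suc n) / 2 ≡ r / 2 + high
  halve = trans (/-congˡ regroup)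
                (trans (+-distrib-/-∣ʳ r (divides-refl high)) (cong (r / 2 +_) (m*n/n≡m high 2)))
  rest : binLSB (suc n) (r / 2 + high) ≡ binLSB n (r / 2) ∷ʳ b
  rest = binLSB-∷ʳ n (r / 2) b (m<n*o⇒m/o<n (subst (r <_) (*-comm 2 (2 ^ n)) r<2ⁿ⁺¹))

binLSB-lower : ∀ n {i} → i < 2 ^ n → binLSB (suc n) i ≡ binLSB n i ∷ʳ zero
binLSB-lower n {i} i<2ⁿ = trans (cong (binLSB (suc n)) (sym (+-identityʳ i))) (binLSB-∷ʳ n i zero i<2ⁿ)

binLSB-upper : ∀ n {j} → j < 2 ^ n → binLSB (suc n) (2 ^ n + j) ≡ binLSB n j ∷ʳ suc zero
binLSB-upper n {j} j<2ⁿ = trans (cong (binLSB (suc n)) reorder) (binLSB-∷ʳ n j (suc zero) j<2ⁿ)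
  where
  reorder : 2 ^ n + j ≡ j + 1 * 2 ^ n
  reorder = trans (+-comm (2 ^ n) j) (cong (j +_) (sym (*-identityˡ (2 ^ n))))

transduced : (n : ℕ) → Letter → Letter → ℕ → Word n
transduced n x y i = reverse (runO x y (reverse (binLSB n i)))

transduced-∷ʳ : ∀ n x y i r b → binLSB (suc n) i ≡ binLSB n r ∷ʳ b →
  transduced (suc n) x y i ≡ reverse (runO x y (b ∷ reverse (binLSB n r)))
transduced-∷ʳ n x y _ r b bits =
  cong (reverse ∘ runO x y) (trans (cong reverse bits) (reverse-∷ʳ (binLSB n r) b))

transduced-lower : ∀ n x y {i} → i < 2 ^ n →
  transduced (suc n) x y i ≡ transduced n x (third x y) i ∷ʳ x
transduced-lower n x y {i} i<2ⁿ =
  trans (transduced-∷ʳ n x y i i zero (binLSB-lower n i<2ⁿ))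
        (reverse-∷ x (runO x (third x y) (reverse (binLSB n i))))

transduced-upper : ∀ n x y {j} → j < 2 ^ n →
  transduced (suc n) x y (2 ^ n + j) ≡ transduced n (third x y) y j ∷ʳ y
transduced-upper n x y {j} j<2ⁿ =
  trans (transduced-∷ʳ n x y (2 ^ n + j) j (suc zero) (binLSB-upper n j<2ⁿ))
        (reverse-∷ y (runO (third x y) y (reverse (binLSB n j))))

transduced-first : ∀ n x y → transduced n x y 0 ≡ const n x
transduced-first zero    x y = refl
transduced-first (suc n) x y = begin
  transduced (suc n) x y 0          ≡⟨ transduced-lower n x y (m^n>0 2 n) ⟩
  transduced n x (third x y) 0 ∷ʳ x ≡⟨ cong (_∷ʳ x) (transduced-first n x (third x y)) ⟩
  const n x ∷ʳ x                    ≡⟨ replicate-∷ʳ n x ⟨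
  const (suc n) x                   ∎
  where open ≡-Reasoning

transduced-last : ∀ n x y → transduced n x y (2 ^ n ∸ 1) ≡ const n y
transduced-last zero    x y = refl
transduced-last (suc n) x y = begin
  transduced (suc n) x y (2 ^ suc n ∸ 1)       ≡⟨ cong (transduced (suc n) x y) upper-half ⟩
  transduced (suc n) x y (2 ^ n + (2 ^ n ∸ 1)) ≡⟨ transduced-upper n x y (≤-reflexive (suc[2^n∸1]≡2^n n)) ⟩
  transduced n (third x y) y (2 ^ n ∸ 1) ∷ʳ y  ≡⟨ cong (_∷ʳ y) (transduced-last n (third x y) y) ⟩
  const n y ∷ʳ y                               ≡⟨ replicate-∷ʳ n y ⟨
  const (suc n) y                              ∎
  where
  open ≡-Reasoning
  upper-half : 2 ^ suc n ∸ 1 ≡ 2 ^ n + (2 ^ n ∸ 1)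
  upper-half = trans (cong (_∸ 1) (2^suc n)) (+-∸-assoc (2 ^ n) (m^n>0 2 n))

transduced-move : ∀ n {x y} → x ≢ y → ∀ k → suc k < 2 ^ n →
  Move (transduced n x y k) (transduced n x y (suc k))
transduced-move zero    _   k (s≤s ())
transduced-move (suc n) {x} {y} x≢y k k+1<2ⁿ⁺¹ with <-cmp (suc k) (2 ^ n)
... | tri< k+1<2ⁿ _ _ =
  subst₂ Move (sym (transduced-lower n x y (<-trans (n<1+n k) k+1<2ⁿ))) (sym (transduced-lower n x y k+1<2ⁿ))
    (Move-∷ʳ x (transduced-move n (third-≢ˡ x≢y ∘ sym) k k+1<2ⁿ))
... | tri≈ _ k+1≡2ⁿ _ = subst₂ Move (sym before) (sym after) (Move-largest n x≢y)
  where
  before : transduced (suc n) x y k ≡ const n (third x y) ∷ʳ x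
  before = trans (transduced-lower n x y (≤-reflexive k+1≡2ⁿ))
                 (cong (_∷ʳ x) (trans (cong (transduced n x (third x y) ∘ (_∸ 1)) k+1≡2ⁿ)
                                      (transduced-last n x (third x y))))
  after : transduced (suc n) x y (suc k) ≡ const n (third x y) ∷ʳ y
  after = trans (cong (transduced (suc n) x y) (trans k+1≡2ⁿ (sym (+-identityʳ (2 ^ n)))))
                (trans (transduced-upper n x y (m^n>0 2 n)) (cong (_∷ʳ y) (transduced-first n (third x y) y)))
... | tri> _ _ 2ⁿ<k+1 with j , refl ← m≤n⇒∃[o]m+o≡n (≤-pred 2ⁿ<k+1) =
  subst₂ Move (sym (transduced-upper n x y (<-trans (n<1+n j) j+1<2ⁿ))) (sym after)
    (Move-∷ʳ y (transduced-move n (third-≢ʳ x≢y) j j+1<2ⁿ))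
  where
  j+1<2ⁿ : suc j < 2 ^ n
  j+1<2ⁿ = +-cancelˡ-< (2 ^ n) (suc j) (2 ^ n) (subst₂ _<_ (sym (+-suc (2 ^ n) j)) (2^suc n) k+1<2ⁿ⁺¹)
  after : transduced (suc n) x y (suc (2 ^ n + j)) ≡ transduced n (third x y) y (suc j) ∷ʳ y
  after = trans (cong (transduced (suc n) x y) (sym (+-suc (2 ^ n) j))) (transduced-upper n x y j+1<2ⁿ)

transducedWalk : ∀ n {x y} → x ≢ y → Walk n (const n x) (const n y) (2 ^ n ∸ 1)
transducedWalk n {x} {y} x≢y = record
  { vtx   = transduced n x y ∘ toℕ
  ; start = transduced-first n x y
  ; end   = trans (cong (transduced n x y) (toℕ-fromℕ (2 ^ n ∸ 1))) (transduced-last n x y)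
  ; step  = λ k → subst (λ i → Adj (transduced n x y i) (transduced n x y (suc (toℕ k)))) (sym (toℕ-inject₁ k))
                        (Move⇒Adj (transduced-move n x≢y (toℕ k) (k+1<2ⁿ k)))
  }
  where
  k+1<2ⁿ : (k : Fin (2 ^ n ∸ 1)) → suc (toℕ k) < 2 ^ n
  k+1<2ⁿ k = subst (suc (toℕ k) <_) (suc[2^n∸1]≡2^n n) (s≤s (toℕ<n k))

-- A transfer of the n-disk tower from peg x to peg y in m moves, indexed by ℕ so that it can be cut
-- and shifted; only config 0, …, config m matter.
record Transfer (n : ℕ) (x y : Letter) (m : ℕ) : Set where
  field
    config : ℕ → Word n
    start  : config 0 ≡ const n x
    end    : config m ≡ const n y
    steps  : ∀ k → k < m → Adj (config k) (config (suc k))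

module LargestDisk {n m : ℕ} {x y : Letter} (x≢y : x ≢ y) (T : Transfer (suc n) x y m) where

  open Transfer T

  smaller : ℕ → Word n
  smaller = init ∘ config

  largest : ℕ → Letter
  largest = last ∘ config

  config-split : ∀ k → config k ≡ smaller k ∷ʳ largest k
  config-split k = proj₂ (proj₂ (initLast (config k)))

  private
    split-const : ∀ {k z} → config k ≡ const (suc n) z → smaller k ≡ const n z × largest k ≡ z
    split-const {k} {z} k-const =
      ∷ʳ-injective _ _ (trans (sym (config-split k)) (trans k-const (replicate-∷ʳ n z)))

    step-split : ∀ k → k < m → Adj (smaller k ∷ʳ largest k) (smaller (suc k) ∷ʳ largest (suc k))
    step-split k k<m = subst₂ Adj (config-split k) (config-split (suc k)) (steps k k<m)

    smaller-step : ∀ k → k < m → largest (suc k) ≡ largest k → Adj (smaller k) (smaller (suc k))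
    smaller-step k k<m unmoved =
      Adj-∷ʳ⁻ (subst (λ c → Adj (smaller k ∷ʳ largest k) (smaller (suc k) ∷ʳ c)) unmoved (step-split k k<m))

    largest-move : ∀ k → k < m → largest k ≢ largest (suc k) →
      smaller k ≡ const n (third (largest k) (largest (suc k))) ×
      smaller (suc k) ≡ const n (third (largest k) (largest (suc k)))
    largest-move k k<m = Adj-∷ʳ-≢ (step-split k k<m)

    largest-start≢end : largest 0 ≢ largest m
    largest-start≢end same = x≢y (trans (sym (proj₂ (split-const start))) (trans same (proj₂ (split-const end))))

  open FirstChange (firstChange _≟ᶠ_ largest m largest-start≢end) public
    renaming (index to a; index<m to a<m; before to largest-≤a; changed to moved-after-a)
  open LastChange (lastChange _≟ᶠ_ largest m largest-start≢end) public
    renaming (index to b; index<m to b<m; changed to moved-after-b; after to largest->b)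

  z z′ : Letter
  z  = largest (suc a)
  z′ = largest b

  largest-x : ∀ k → k ≤ a → largest k ≡ x
  largest-x k k≤a = trans (largest-≤a k k≤a) (proj₂ (split-const start))

  largest-y : ∀ k → b < k → k ≤ m → largest k ≡ y
  largest-y k b<k k≤m = trans (largest->b k b<k k≤m) (proj₂ (split-const end))

  x≢z : x ≢ z
  x≢z x≡z = moved-after-a (trans (sym x≡z) (sym (largest-x 0 z≤n)))

  z′≢y : z′ ≢ y
  z′≢y z′≡y = moved-after-b (trans z′≡y (sym (proj₂ (split-const end))))

  prefix-distinct : x ≢ third x z
  prefix-distinct = third-≢ˡ x≢z ∘ sym

  suffix-distinct : third z′ y ≢ y
  suffix-distinct = third-≢ʳ z′≢y

  private
    moves-at-a : largest a ≢ largest (suc a)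
    moves-at-a = x≢z ∘ trans (sym (largest-x a ≤-refl))

    moves-at-b : largest b ≢ largest (suc b)
    moves-at-b unmoved = z′≢y (trans unmoved (largest-y (suc b) ≤-refl b<m))

  a≤b : a ≤ b
  a≤b with a ≤? b
  ... | yes a≤b = a≤b
  ... | no a≰b  = ⊥-elim (x≢y (trans (sym (largest-x (suc b) (≰⇒> a≰b))) (largest-y (suc b) ≤-refl b<m)))

  prefix : Transfer n x (third x z) a
  prefix = record
    { config = smaller
    ; start  = proj₁ (split-const start)
    ; end    = trans (proj₁ (largest-move a a<m moves-at-a)) (cong (λ c → const n (third c z)) (largest-x a ≤-refl))
    ; steps  = λ k k<a → smaller-step k (<-trans k<a a<m)
                           (trans (largest-x (suc k) k<a) (sym (largest-x k (<⇒≤ k<a))))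
    }

  c : ℕ
  c = m ∸ suc b

  b+1+c≡m : suc b + c ≡ m
  b+1+c≡m = m+[n∸m]≡n b<m

  suffix : Transfer n (third z′ y) y c
  suffix = record
    { config = λ j → smaller (suc b + j)
    ; start  = trans (cong smaller (+-identityʳ (suc b)))
                     (trans (proj₂ (largest-move b b<m moves-at-b))
                            (cong (λ c → const n (third z′ c)) (largest-y (suc b) ≤-refl b<m)))
    ; end    = trans (cong smaller b+1+c≡m) (proj₁ (split-const end))
    ; steps  = suffix-step
    }
    where
    suffix-step : ∀ j → j < c → Adj (smaller (suc b + j)) (smaller (suc b + suc j))
    suffix-step j j<c = subst (λ k → Adj (smaller (suc b + j)) (smaller k)) (sym (+-suc (suc b) j))
      (smaller-step (suc b + j) k<m (trans (largest-y (suc k) (s≤s (≤-trans (m≤m+n b j) (n≤1+n _))) k<m)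
                                           (sym (largest-y k (s≤s (m≤m+n b j)) (<⇒≤ k<m)))))
      where
      k : ℕ
      k = suc b + j
      k<m : k < m
      k<m = subst (_≤ m) (+-suc (suc b) j) (≤-trans (+-mono-≤ (≤-refl {suc b}) j<c) (≤-reflexive b+1+c≡m))

  length-split : suc b + suc c ≡ suc m
  length-split = trans (+-suc (suc b) c) (cong suc b+1+c≡m)

  module Tight (prefix-long : 2 ^ n ≤ suc a) (suffix-long : 2 ^ n ≤ suc c) (shortest : suc m ≡ 2 ^ suc n)
    where

    private
      squeezed : suc a ≡ 2 ^ n × suc b ≡ 2 ^ n × suc c ≡ 2 ^ n
      squeezed = sum-squeeze prefix-long (s≤s a≤b) suffix-long (trans length-split (trans shortest (2^suc n)))

    a+1≡2ⁿ : suc a ≡ 2 ^ n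
    a+1≡2ⁿ = proj₁ squeezed

    c+1≡2ⁿ : suc c ≡ 2 ^ n
    c+1≡2ⁿ = proj₂ (proj₂ squeezed)

    a≡b : a ≡ b
    a≡b = suc-injective (trans a+1≡2ⁿ (sym (proj₁ (proj₂ squeezed))))

    z≡y : z ≡ y
    z≡y = trans (cong (largest ∘ suc) a≡b) (largest-y (suc b) ≤-refl b<m)

    z′≡x : z′ ≡ x
    z′≡x = trans (cong largest (sym a≡b)) (largest-x a ≤-refl)

transfer-length-≥ : ∀ n {m x y} → x ≢ y → Transfer n x y m → 2 ^ n ≤ suc m
transfer-length-≥ zero    _   _ = s≤s z≤n
transfer-length-≥ (suc n) {m} x≢y T = begin
  2 ^ suc n     ≡⟨ 2^suc n ⟩
  2 ^ n + 2 ^ n ≤⟨ +-mono-≤ (transfer-length-≥ n prefix-distinct prefix) (transfer-length-≥ n suffix-distinct suffix) ⟩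
  suc a + suc c ≤⟨ +-mono-≤ (s≤s a≤b) (≤-refl {suc c}) ⟩
  suc b + suc c ≡⟨ length-split ⟩
  suc m         ∎
  where
  open LargestDisk x≢y T
  open ≤-Reasoning

shortest-transfer-config : ∀ n {m x y} → x ≢ y → (T : Transfer n x y m) → suc m ≡ 2 ^ n →
  ∀ i → i ≤ m → Transfer.config T i ≡ transduced n x y i
shortest-transfer-config zero _ T _ i _ with Transfer.config T i
... | [] = refl
shortest-transfer-config (suc n) {m} {x} {y} x≢y T shortest = by-half
  where
  open Transfer T
  open LargestDisk x≢y T
  open Tight (transfer-length-≥ n prefix-distinct prefix) (transfer-length-≥ n suffix-distinct suffix) shortest
  open ≡-Reasoning

  by-half : ∀ i → i ≤ m → config i ≡ transduced (suc n) x y i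
  by-half i i≤m with i ≤? a
  ... | yes i≤a = begin
    config i                          ≡⟨ config-split i ⟩
    smaller i ∷ʳ largest i            ≡⟨ cong₂ _∷ʳ_ prefix-value (largest-x i i≤a) ⟩
    transduced n x (third x z) i ∷ʳ x ≡⟨ cong (λ t → transduced n x (third x t) i ∷ʳ x) z≡y ⟩
    transduced n x (third x y) i ∷ʳ x ≡⟨ transduced-lower n x y (subst (i <_) a+1≡2ⁿ (s≤s i≤a)) ⟨
    transduced (suc n) x y i          ∎
    where
    prefix-value : smaller i ≡ transduced n x (third x z) i
    prefix-value = shortest-transfer-config n prefix-distinct prefix a+1≡2ⁿ i i≤a
  ... | no i≰a with j , refl ← m≤n⇒∃[o]m+o≡n (≰⇒> i≰a) = begin
    config (suc a + j)                               ≡⟨ config-split (suc a + j) ⟩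
    smaller (suc a + j) ∷ʳ largest (suc a + j)       ≡⟨ cong₂ _∷ʳ_ suffix-value (largest-y (suc a + j) b<a+1+j i≤m) ⟩
    transduced n (third z′ y) y j ∷ʳ y               ≡⟨ cong (λ t → transduced n (third t y) y j ∷ʳ y) z′≡x ⟩
    transduced n (third x y) y j ∷ʳ y                ≡⟨ transduced-upper n x y j<2ⁿ ⟨
    transduced (suc n) x y (2 ^ n + j)               ≡⟨ cong (λ k → transduced (suc n) x y (k + j)) a+1≡2ⁿ ⟨
    transduced (suc n) x y (suc a + j)               ∎
    where
    b<a+1+j : b < suc a + j
    b<a+1+j = s≤s (subst (_≤ a + j) a≡b (m≤m+n a j))
    j≤c : j ≤ c
    j≤c = +-cancelˡ-≤ (suc b) j c (subst₂ _≤_ (cong (λ k → suc k + j) a≡b) (sym b+1+c≡m) i≤m)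
    j<2ⁿ : j < 2 ^ n
    j<2ⁿ = subst (j <_) c+1≡2ⁿ (s≤s j≤c)
    suffix-value : smaller (suc a + j) ≡ transduced n (third z′ y) y j
    suffix-value = trans (cong (λ k → smaller (suc k + j)) a≡b)
                         (shortest-transfer-config n suffix-distinct suffix c+1≡2ⁿ j j≤c)

module _ {n m : ℕ} {x y : Letter} (p : Walk n (const n x) (const n y) m) where

  open Walk p

  walkConfig : ℕ → Word n
  walkConfig k = vtx (k mod suc m)

  vtx≡walkConfig : ∀ {k} (K : Fin (suc m)) → toℕ K ≡ k → vtx K ≡ walkConfig k
  vtx≡walkConfig K refl = cong vtx (toℕ-injective (sym (trans (toℕ-fromℕ< _) (m≤n⇒m%n≡m (toℕ≤pred[n] K)))))

  Walk⇒Transfer : Transfer n x y m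
  Walk⇒Transfer = record
    { config = walkConfig
    ; start  = trans (sym (vtx≡walkConfig zero refl)) start
    ; end    = trans (sym (vtx≡walkConfig (fromℕ m) (toℕ-fromℕ m))) end
    ; steps  = walkConfig-steps
    }
    where
    walkConfig-steps : ∀ k → k < m → Adj (walkConfig k) (walkConfig (suc k))
    walkConfig-steps k k<m =
      subst₂ Adj (vtx≡walkConfig (inject₁ K) (trans (toℕ-inject₁ K) (toℕ-fromℕ< k<m)))
                 (vtx≡walkConfig (suc K) (cong suc (toℕ-fromℕ< k<m)))
                 (step K)
      where
      K : Fin m
      K = fromℕ< k<m

Walk-length-≥ : ∀ {n m x y} → x ≢ y → Walk n (const n x) (const n y) m → 2 ^ n ∸ 1 ≤ m
Walk-length-≥ {n} x≢y p = ∸-monoˡ-≤ 1 (transfer-length-≥ n x≢y (Walk⇒Transfer p))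

shortest-Walk-vtx : ∀ {n m x y} → x ≢ y → (p : Walk n (const n x) (const n y) m) → m ≡ 2 ^ n ∸ 1 →
  (k : Fin (suc m)) → Walk.vtx p k ≡ transduced n x y (toℕ k)
shortest-Walk-vtx {n} x≢y p refl k = trans (vtx≡walkConfig p k refl)
  (shortest-transfer-config n x≢y (Walk⇒Transfer p) (suc[2^n∸1]≡2^n n) (toℕ k) (toℕ≤pred[n] k))

mainTheorem8 : (n : ℕ) → 1 ≤ n → (x y : Letter) → ¬ (x ≡ y)
    → (Σ ℕ λ m → Σ (Walk n (const n x) (const n y) m) IsShortest)
    × (∀ m (p : Walk n (const n x) (const n y) m) → IsShortest p
    → (m ≡ 2 ^ n ∸ 1)
    × (∀ (i : ℕ) → i < 2 ^ n → (k : Fin _) → toℕ k ≡ i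
    → Walk.vtx p k ≡ reverse (runO x y (reverse (binLSB n i)))))
mainTheorem8 n _ x y x≢y =
  (2 ^ n ∸ 1 , transducedWalk n x≢y , λ _ → Walk-length-≥ x≢y) ,
  λ m p p-shortest →
    let m≡2ⁿ∸1 : m ≡ 2 ^ n ∸ 1
        m≡2ⁿ∸1 = ≤-antisym (p-shortest _ (transducedWalk n x≢y)) (Walk-length-≥ x≢y p)
    in  m≡2ⁿ∸1 , λ { _ _ k refl → shortest-Walk-vtx x≢y p m≡2ⁿ∸1 k }
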